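{- Let $3\le m\le n$ and let $c$ be an exact $(m+n+1)$-coloring of $[m]\times[n]$ with no rainbow solution to $x_1+x_2=x_3$ and with $|c(D_m)|=3$. Then there is no jump from any $\alpha$ to any $\beta$ with $c(\alpha),c(\beta)\notin c(D_m)$ and $c(\alpha)\ne c(\beta)$.
   Context: $[m]\times[n]=\{(i,j)\in\mathbb{Z}^2:1\le i\le m,1\le j\le n\}$ with componentwise addition. An $r$-coloring is a map $c:[m]\times[n]\to\{1,\dots,r\}$, exact if surjective; a rainbow solution is a triple $\alpha,\beta,\gamma$ with $\alpha+\beta=\gamma$ and pairwise distinct colors. $D_k=\{(i,j)\in[m]\times[n]:m-k=i-j\}$, $D_m$ the main diagonal, $c(X)=\{c(x):x\in X\}$. For $\alpha=(a_1,a_2)\in D_a$, $\beta=(b_1,b_2)\in D_b$ with $a\ne b$, there is a jump from $\alpha$ to $\beta$ if $a_1<b_1$ and $a_2<b_2$. -}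

module Defs where

open import Data.Nat using (ℕ; _+_; _∸_; _≤_; _<_)
open import Data.Product using (_×_; Σ; ∃; _,_)
open import Relation.Binary.PropositionalEquality using (_≡_; _≢_)
open import Relation.Nullary using (¬_)
open import Data.Sum using (_⊎_)

Point : Set
Point = ℕ × ℕ

InGrid : ℕ → ℕ → Point → Set
InGrid m n (i , j) = (1 ≤ i × i ≤ m) × (1 ≤ j × j ≤ n)

_⊕_ : Point → Point → Point
(a₁ , a₂) ⊕ (b₁ , b₂) = (a₁ + b₁ , a₂ + b₂)

IsColoring : ℕ → ℕ → ℕ → (Point → ℕ) → Set
IsColoring m n r c = ∀ p → InGrid m n p → 1 ≤ c p × c p ≤ r

IsExactColoring : ℕ → ℕ → ℕ → (Point → ℕ) → Set
IsExactColoring m n r c =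
  IsColoring m n r c × (∀ k → 1 ≤ k → k ≤ r → Σ Point λ p → InGrid m n p × c p ≡ k)

RainbowSolution : ℕ → ℕ → (Point → ℕ) → Point → Point → Point → Set
RainbowSolution m n c α β γ =
  InGrid m n α × InGrid m n β × InGrid m n γ × (α ⊕ β ≡ γ) ×
  (c α ≢ c β) × (c α ≢ c γ) × (c β ≢ c γ)

NoRainbow : ℕ → ℕ → (Point → ℕ) → Set
NoRainbow m n c = ∀ α β γ → ¬ RainbowSolution m n c α β γ

-- diagonal index: (i , j) ∈ D_k iff m - k = i - j, i.e. k = m - i + j
-- (for points of the grid i ≤ m, so truncated subtraction is exact)
diagIndex : ℕ → Point → ℕ
diagIndex m (i , j) = (m ∸ i) + j

InDiag : ℕ → ℕ → ℕ → Point → Set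
InDiag m n k p = InGrid m n p × diagIndex m p ≡ k

InColorsMainDiag : ℕ → ℕ → (Point → ℕ) → ℕ → Set
InColorsMainDiag m n c x = Σ Point λ p → InDiag m n m p × c p ≡ x

MainDiagHas3Colors : ℕ → ℕ → (Point → ℕ) → Set
MainDiagHas3Colors m n c =
  Σ ℕ λ x → Σ ℕ λ y → Σ ℕ λ z →
    (x ≢ y) × (x ≢ z) × (y ≢ z) ×
    InColorsMainDiag m n c x × InColorsMainDiag m n c y × InColorsMainDiag m n c z ×
    (∀ w → InColorsMainDiag m n c w → (w ≡ x) ⊎ (w ≡ y) ⊎ (w ≡ z))

Jump : ℕ → ℕ → Point → Point → Set
Jump m n (a₁ , a₂) (b₁ , b₂) =
  InGrid m n (a₁ , a₂) × InGrid m n (b₁ , b₂) ×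
  (diagIndex m (a₁ , a₂) ≢ diagIndex m (b₁ , b₂)) × (a₁ < b₁) × (a₂ < b₂)

{-# OPTIONS --safe #-}
-- Call a grid point off if its colour is not one of the three colours of the main diagonal.
-- If p and p + (t, t) are both off, the triple p, (t, t), p + (t, t) is not rainbow, so they share
-- a colour: every other diagonal carries at most one off colour.  There are m + n − 2 off colours
-- and m + n − 2 other diagonals, so by pigeonhole each off colour lives on exactly one diagonal
-- and every other diagonal carries an off point.  If α jumps to β with c α ≢ c β, the triple
-- α, β − α, β forces β − α to have the colour, hence the diagonal, of α: the offset j − i doubles
-- from α to β.  For an offset k ≥ 2 an off point r of offset k + 1 then gives a jump α → r or
-- r → β whose offset does not double.  For k = 1 a point of offset 3 forces α = (1, 2), which a
-- point just below the main diagonal rules out.  Finally m = 3 is impossible, since then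
-- (1, 1) + (2, 2) = (3, 3) would be a rainbow solution.
module Submission where

open import Defs
open import Data.Empty using (⊥; ⊥-elim)
open import Data.Fin using (Fin; toℕ; fromℕ<; punchOut)
import Data.Fin.Properties as Fin
open import Data.List using ([]; _∷_)
open import Data.Nat using (ℕ; zero; suc; _+_; _∸_; _≤_; _<_; z≤n; s≤s; _≟_; _<?_; _≤?_)
open import Data.Nat.Properties
open import Algebra.Properties.CommutativeSemigroup +-commutativeSemigroup using (xy∙z≈xz∙y)
open import Data.Nat.Tactic.RingSolver using (solve)
open import Data.Product using (_×_; Σ; ∃-syntax; ∃₂; _,_; proj₁; proj₂; swap)
open import Data.Sum using (_⊎_; inj₁; inj₂; [_,_])
open import Function using (_∘_)
open import Function.Definitions using (Injective)
open import Relation.Binary using (tri<; tri≈; tri>)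
open import Relation.Binary.PropositionalEquality hiding ([_])
open import Relation.Nullary using (¬_; yes; no; contradiction)

injection-into-range-onto : ∀ {N} (f : Fin N → ℕ) → (∀ i → f i < N) →
  Injective _≡_ _≡_ f → ∀ e → e < N → ∃[ i ] f i ≡ e
injection-into-range-onto {suc N} f f<N f-injective e e<N with Fin.any? (λ i → f i ≟ e)
... | yes hit = hit
... | no miss = contradiction (Fin.injective⇒≤ punched-injective) 1+n≰n
  where
    avoids : ∀ i → fromℕ< e<N ≢ fromℕ< (f<N i)
    avoids i eq = miss (i , sym (Fin.fromℕ<-injective e (f i) e<N (f<N i) eq))
    punched : Fin (suc N) → Fin N
    punched i = punchOut (avoids i)
    punched-injective : Injective _≡_ _≡_ punched
    punched-injective {i} {j} eq = f-injective
      (Fin.fromℕ<-injective (f i) (f j) (f<N i) (f<N j) (Fin.punchOut-injective (avoids i) (avoids j) eq))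

SameDiagonal : Point → Point → Set
SameDiagonal (p₁ , p₂) (q₁ , q₂) = p₁ + q₂ ≡ q₁ + p₂

data Above (k : ℕ) : Point → Set where
  at : ∀ i → Above k (i , k + i)

above-≡ : ∀ {k i j} → j ≡ k + i → Above k (i , j)
above-≡ {i = i} refl = at i

-- q − p lies on the diagonal of p, i.e. the offset j − i doubles from p to q
StepOnDiagonal : Point → Point → Set
StepOnDiagonal (p₁ , p₂) (q₁ , q₂) = p₁ + p₁ + q₂ ≡ p₂ + p₂ + q₁

module _ where
  open ≡-Reasoning

  sameDiagonal-swap : ∀ p q → SameDiagonal p q → SameDiagonal (swap p) (swap q)
  sameDiagonal-swap (p₁ , p₂) (q₁ , q₂) same = begin
    p₂ + q₁ ≡⟨ +-comm p₂ q₁ ⟩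
    q₁ + p₂ ≡⟨ sym same ⟩
    p₁ + q₂ ≡⟨ +-comm p₁ q₂ ⟩
    q₂ + p₁ ∎

  sameDiagonal-⊕ʳ : ∀ p q → SameDiagonal p (p ⊕ q) → proj₁ q ≡ proj₂ q
  sameDiagonal-⊕ʳ (p₁ , p₂) (q₁ , q₂) same = sym (+-cancelˡ-≡ (p₁ + p₂) q₂ q₁ (begin
    p₁ + p₂ + q₂   ≡⟨ solve (p₁ ∷ p₂ ∷ q₂ ∷ []) ⟩
    p₁ + (p₂ + q₂) ≡⟨ same ⟩
    p₁ + q₁ + p₂   ≡⟨ solve (p₁ ∷ p₂ ∷ q₁ ∷ []) ⟩
    p₁ + p₂ + q₁   ∎))

  sameDiagonal-⊕ˡ : ∀ p q → SameDiagonal q (p ⊕ q) → proj₁ p ≡ proj₂ p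
  sameDiagonal-⊕ˡ (p₁ , p₂) (q₁ , q₂) same = sym (+-cancelˡ-≡ (q₁ + q₂) p₂ p₁ (begin
    q₁ + q₂ + p₂   ≡⟨ solve (p₂ ∷ q₁ ∷ q₂ ∷ []) ⟩
    q₁ + (p₂ + q₂) ≡⟨ same ⟩
    p₁ + q₁ + q₂   ≡⟨ solve (p₁ ∷ q₁ ∷ q₂ ∷ []) ⟩
    q₁ + q₂ + p₁   ∎))

  sameDiagonal⇒stepOnDiagonal : ∀ p q → SameDiagonal p q → StepOnDiagonal p (p ⊕ q)
  sameDiagonal⇒stepOnDiagonal (p₁ , p₂) (q₁ , q₂) same = begin
    p₁ + p₁ + (p₂ + q₂)   ≡⟨ solve (p₁ ∷ p₂ ∷ q₂ ∷ []) ⟩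
    p₁ + p₂ + (p₁ + q₂)   ≡⟨ cong (p₁ + p₂ +_) same ⟩
    p₁ + p₂ + (q₁ + p₂)   ≡⟨ solve (p₁ ∷ p₂ ∷ q₁ ∷ []) ⟩
    p₂ + p₂ + (p₁ + q₁)   ∎

  sameDiagonal-above : ∀ {k p q} → Above k p → SameDiagonal p q → Above k q
  sameDiagonal-above {k} {q = q₁ , q₂} (at p₁) same = above-≡ (+-cancelˡ-≡ p₁ q₂ (k + q₁) (begin
    p₁ + q₂       ≡⟨ same ⟩
    q₁ + (k + p₁) ≡⟨ solve (k ∷ p₁ ∷ q₁ ∷ []) ⟩
    p₁ + (k + q₁) ∎))

  above-sameDiagonal : ∀ {s t p q} → Above s p → Above t q → SameDiagonal p q → s ≡ t
  above-sameDiagonal {s} {t} (at p₁) (at q₁) same = +-cancelˡ-≡ (p₁ + q₁) s t (begin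
    p₁ + q₁ + s   ≡⟨ solve (s ∷ p₁ ∷ q₁ ∷ []) ⟩
    q₁ + (s + p₁) ≡⟨ sym same ⟩
    p₁ + (t + q₁) ≡⟨ solve (t ∷ p₁ ∷ q₁ ∷ []) ⟩
    p₁ + q₁ + t   ∎)

  above-⊕ : ∀ {s t p q} → Above s p → Above t q → Above (s + t) (p ⊕ q)
  above-⊕ {s} {t} (at p₁) (at q₁) = above-≡ (begin
    s + p₁ + (t + q₁) ≡⟨ solve (s ∷ t ∷ p₁ ∷ q₁ ∷ []) ⟩
    s + t + (p₁ + q₁) ∎)

  stepOnDiagonal-above : ∀ {s t p q} → Above s p → Above t q → StepOnDiagonal p q → t ≡ s + s
  stepOnDiagonal-above {s} {t} (at p₁) (at q₁) step = +-cancelˡ-≡ (p₁ + p₁ + q₁) t (s + s) (begin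
    p₁ + p₁ + q₁ + t             ≡⟨ solve (t ∷ p₁ ∷ q₁ ∷ []) ⟩
    p₁ + p₁ + (t + q₁)           ≡⟨ step ⟩
    s + p₁ + (s + p₁) + q₁       ≡⟨ solve (s ∷ p₁ ∷ q₁ ∷ []) ⟩
    p₁ + p₁ + q₁ + (s + s)       ∎)

sameDiagonal-< : ∀ {p q} → SameDiagonal p q → proj₁ p < proj₁ q → proj₂ p < proj₂ q
sameDiagonal-< {p₁ , p₂} {q₁ , q₂} same p₁<q₁ =
  +-cancelˡ-< p₁ p₂ q₂ (<-≤-trans (+-monoˡ-< p₂ p₁<q₁) (≤-reflexive (sym same)))

above-difference : ∀ {i j} → i < j → Above (j ∸ i) (i , j)
above-difference i<j = above-≡ (sym (m∸n+n≡m (<⇒≤ i<j)))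

above-< : ∀ {s t p q} → Above s p → Above t q → s + proj₁ p < t + proj₁ q → proj₂ p < proj₂ q
above-< (at _) (at _) lt = lt

InGrid-swap : ∀ {m n p} → InGrid m n p → InGrid n m (swap p)
InGrid-swap (gi , gj) = gj , gi

jump-difference : ∀ {m n p q} → proj₁ p < proj₁ q → proj₂ p < proj₂ q → InGrid m n q →
  ∃[ δ ] InGrid m n δ × p ⊕ δ ≡ q
jump-difference {p = p₁ , p₂} {q₁ , q₂} p₁<q₁ p₂<q₂ ((_ , q₁≤m) , (_ , q₂≤n)) =
  (q₁ ∸ p₁ , q₂ ∸ p₂) ,
  ((m<n⇒0<n∸m p₁<q₁ , ≤-trans (m∸n≤m q₁ p₁) q₁≤m) , (m<n⇒0<n∸m p₂<q₂ , ≤-trans (m∸n≤m q₂ p₂) q₂≤n)) ,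
  cong₂ _,_ (m+[n∸m]≡n (<⇒≤ p₁<q₁)) (m+[n∸m]≡n (<⇒≤ p₂<q₂))

module _ {m n : ℕ} where
  open ≡-Reasoning

  diagIndex-spec : ∀ {p} → InGrid m n p → diagIndex m p + proj₁ p ≡ m + proj₂ p
  diagIndex-spec {i , j} ((_ , i≤m) , _) = begin
    m ∸ i + j + i ≡⟨ xy∙z≈xz∙y (m ∸ i) j i ⟩
    m ∸ i + i + j ≡⟨ cong (_+ j) (m∸n+n≡m i≤m) ⟩
    m + j         ∎

  diagIndex≡⇒sameDiagonal : ∀ {p q} → InGrid m n p → InGrid m n q →
    diagIndex m p ≡ diagIndex m q → SameDiagonal p q
  diagIndex≡⇒sameDiagonal {p₁ , p₂} {q₁ , q₂} gp gq eq = +-cancelˡ-≡ m (p₁ + q₂) (q₁ + p₂) (begin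
    m + (p₁ + q₂)     ≡⟨ solve (m ∷ p₁ ∷ q₂ ∷ []) ⟩
    m + q₂ + p₁       ≡⟨ cong (_+ p₁) (sym (diagIndex-spec gq)) ⟩
    dq + q₁ + p₁      ≡⟨ cong (λ d → d + q₁ + p₁) (sym eq) ⟩
    dp + q₁ + p₁      ≡⟨ xy∙z≈xz∙y dp q₁ p₁ ⟩
    dp + p₁ + q₁      ≡⟨ cong (_+ q₁) (diagIndex-spec gp) ⟩
    m + p₂ + q₁       ≡⟨ solve (m ∷ p₂ ∷ q₁ ∷ []) ⟩
    m + (q₁ + p₂)     ∎)
    where
      dp dq : ℕ
      dp = diagIndex m (p₁ , p₂)
      dq = diagIndex m (q₁ , q₂)

  diagIndex≡m⇒onMain : ∀ {p} → InGrid m n p → diagIndex m p ≡ m → proj₁ p ≡ proj₂ p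
  diagIndex≡m⇒onMain {i , j} g eq = +-cancelˡ-≡ m i j (begin
    m + i               ≡⟨ cong (_+ i) (sym eq) ⟩
    diagIndex m (i , j) + i ≡⟨ diagIndex-spec g ⟩
    m + j               ∎)

  onMain⇒diagIndex≡m : ∀ {p} → InGrid m n p → proj₁ p ≡ proj₂ p → diagIndex m p ≡ m
  onMain⇒diagIndex≡m {i , j} g i≡j = +-cancelʳ-≡ i (diagIndex m (i , j)) m (begin
    diagIndex m (i , j) + i ≡⟨ diagIndex-spec g ⟩
    m + j                   ≡⟨ cong (m +_) (sym i≡j) ⟩
    m + i                   ∎)

  diagIndex>0 : ∀ {p} → InGrid m n p → 0 < diagIndex m p
  diagIndex>0 {i , j} ((_ , i≤m) , (1≤j , _)) = <-≤-trans 1≤j (m≤n+m j (m ∸ i))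

  diagIndex<m+n : ∀ {p} → InGrid m n p → diagIndex m p < m + n
  diagIndex<m+n {i , j} g@((1≤i , _) , (_ , j≤n)) = +-cancelʳ-< i (diagIndex m (i , j)) (m + n)
    (≤-<-trans (≤-reflexive (diagIndex-spec g)) (≤-<-trans (+-monoʳ-≤ m j≤n) (m<m+n (m + n) 1≤i)))

  diagIndex≡m+t⇒above : ∀ {p t} → InGrid m n p → diagIndex m p ≡ m + t → Above t p
  diagIndex≡m+t⇒above {i , j} {t} g eq = above-≡ (+-cancelˡ-≡ m j (t + i) (begin
    m + j                   ≡⟨ sym (diagIndex-spec g) ⟩
    diagIndex m (i , j) + i ≡⟨ cong (_+ i) eq ⟩
    m + t + i               ≡⟨ +-assoc m t i ⟩
    m + (t + i)             ∎))

  diagIndex≡m∸t⇒below : ∀ {p t} → InGrid m n p → t ≤ m → diagIndex m p ≡ m ∸ t → Above t (swap p)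
  diagIndex≡m∸t⇒below {i , j} {t} g t≤m eq = above-≡ (+-cancelˡ-≡ m i (t + j) (begin
    m + i                       ≡⟨ cong (_+ i) (sym (m∸n+n≡m t≤m)) ⟩
    m ∸ t + t + i               ≡⟨ xy∙z≈xz∙y (m ∸ t) t i ⟩
    m ∸ t + i + t               ≡⟨ cong (λ d → d + i + t) (sym eq) ⟩
    diagIndex m (i , j) + i + t ≡⟨ cong (_+ t) (diagIndex-spec g) ⟩
    m + j + t                   ≡⟨ solve (m ∷ j ∷ t ∷ []) ⟩
    m + (t + j)                 ∎))

-- The off points are axiomatised so that the argument applies verbatim to the transposed grid.
module DoublingSums (m n : ℕ) (4≤m : 4 ≤ m) (4≤n : 4 ≤ n) (Off : Point → Set)
  (Off⇒InGrid : ∀ {p} → Off p → InGrid m n p)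
  (sum-outside : ∀ {p q} → Off p → Off q → ¬ SameDiagonal p q → ¬ InGrid m n (p ⊕ q))
  (jump-steps-on-diagonal : ∀ {p q} → Off p → Off q → ¬ SameDiagonal p q →
     proj₁ p < proj₁ q → proj₂ p < proj₂ q → StepOnDiagonal p q)
  (above : ∀ t → 1 ≤ t → t < n → ∃[ x ] Off (x , t + x))
  (just-below : ∃[ y ] Off (1 + y , y)) where

  jump-doubles-offset : ∀ {s t p q} → Above s p → Above t q → s ≢ t → Off p → Off q →
    proj₁ p < proj₁ q → s + proj₁ p < t + proj₁ q → t ≡ s + s
  jump-doubles-offset ap aq s≢t op oq lt₁ lt₂ = stepOnDiagonal-above ap aq
    (jump-steps-on-diagonal op oq (s≢t ∘ above-sameDiagonal ap aq) lt₁ (above-< ap aq lt₂))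

  no-offset-between : ∀ {k t p r q} → k < t → t < k + k →
    Above k p → Above t r → Above (k + k) q → proj₁ p < proj₁ q → Off p → Off r → Off q → ⊥
  no-offset-between k<t t<2k (at a) (at x) (at b) a<b op or oq with a <? x
  ... | yes a<x = <⇒≢ t<2k (jump-doubles-offset (at a) (at x) (<⇒≢ k<t) op or a<x (+-mono-< k<t a<x))
  ... | no a≮x = <⇒≢ (+-mono-< k<t k<t)
        (jump-doubles-offset (at x) (at b) (<⇒≢ t<2k) or oq x<b (+-mono-< t<2k x<b))
    where
      x<b : x < b
      x<b = ≤-<-trans (≮⇒≥ a≮x) a<b

  offset3-left-of-offset1 : ∀ {p r} → Above 1 p → Above 3 r → Off p → Off r → proj₁ r ≤ proj₁ p
  offset3-left-of-offset1 (at d) (at x) op or with d <? x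
  ... | yes d<x = contradiction
        (jump-doubles-offset (at d) (at x) (λ ()) op or d<x (+-mono-< (s≤s (s≤s z≤n)) d<x)) (λ ())
  ... | no d≮x = ≮⇒≥ d≮x

  offset1-sum-starts-at-1 : ∀ {p q} → Above 1 p → Above 1 q → Off p → Off q → Off (p ⊕ q) →
    proj₁ p ≡ 1
  offset1-sum-starts-at-1 (at a) (at d) op oq os with above 3 (s≤s z≤n) 4≤n
  ... | x , or with suc x <? a + d
  ...   | yes x+1<a+d = contradiction (jump-doubles-offset (at x) (above-⊕ {1} {1} (at a) (at d)) (λ ()) or os
          (<-trans (n<1+n x) x+1<a+d) (s≤s (s≤s x+1<a+d))) (λ ())
  ...   | no x+1≮a+d = ≤-antisym (+-cancelʳ-≤ d a 1 a+d≤1+d) (proj₁ (proj₁ (Off⇒InGrid op)))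
    where
      a+d≤1+d : a + d ≤ 1 + d
      a+d≤1+d = ≤-trans (≮⇒≥ x+1≮a+d) (s≤s (offset3-left-of-offset1 (at d) (at x) oq or))

  corner-not-Off : ∀ {y} → Off (suc y , y) → ¬ Off (1 , 2)
  corner-not-Off {y} o′ o with y ≤? 2
  ... | yes y≤2 = sum-outside o o′ (m+1+n≢m y ∘ sym ∘ suc-injective) sum-in-grid
    where
      y+2≤4 : 2 + y ≤ 4
      y+2≤4 = s≤s (s≤s y≤2)
      sum-in-grid : InGrid m n (2 + y , 2 + y)
      sum-in-grid = (s≤s z≤n , ≤-trans y+2≤4 4≤m) , (s≤s z≤n , ≤-trans y+2≤4 4≤n)
  ... | no y≰2 = m≢1+n+m y (suc-injective (suc-injective
          (jump-steps-on-diagonal o o′ (m+1+n≢m y ∘ sym ∘ suc-injective) (s≤s 0<y) 2<y)))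
    where
      2<y : 2 < y
      2<y = ≰⇒> y≰2
      0<y : 0 < y
      0<y = <-trans (s≤s z≤n) 2<y

  no-doubling-sum : ∀ {k p q} → 1 ≤ k → Above k p → Above k q → Off p → Off q → ¬ Off (p ⊕ q)
  no-doubling-sum {suc zero} _ ap@(at _) aq op oq os with refl ← offset1-sum-starts-at-1 ap aq op oq os =
    corner-not-Off (proj₂ just-below) op
  no-doubling-sum {k@(suc (suc _))} _ ap@(at a) aq@(at d) op oq os
    = let x , or = above (suc k) (s≤s z≤n) (<-≤-trans k+1<2k 2k≤n)
      in no-offset-between (n<1+n k) k+1<2k ap (at x) (above-⊕ ap aq) (m<m+n a 1≤d) op or os
    where
      k+1<2k : suc k < k + k
      k+1<2k = subst (_< k + k) (+-comm k 1) (+-monoʳ-< k (s≤s (s≤s z≤n)))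
      2k≤n : k + k ≤ n
      2k≤n = ≤-trans (+-mono-≤ (m≤m+n k a) (m≤m+n k d)) (proj₂ (proj₂ (Off⇒InGrid os)))
      1≤d : 1 ≤ d
      1≤d = proj₁ (proj₁ (Off⇒InGrid oq))

three-distinct-in-pair : ∀ {A : Set} {x y z u v : A} → x ≢ y → x ≢ z → y ≢ z →
  x ≡ u ⊎ x ≡ v → y ≡ u ⊎ y ≡ v → z ≡ u ⊎ z ≡ v → ⊥
three-distinct-in-pair x≢y _ _ (inj₁ x≡u) (inj₁ y≡u) _ = x≢y (trans x≡u (sym y≡u))
three-distinct-in-pair x≢y _ _ (inj₂ x≡v) (inj₂ y≡v) _ = x≢y (trans x≡v (sym y≡v))
three-distinct-in-pair _ x≢z _ (inj₁ x≡u) _ (inj₁ z≡u) = x≢z (trans x≡u (sym z≡u))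
three-distinct-in-pair _ x≢z _ (inj₂ x≡v) _ (inj₂ z≡v) = x≢z (trans x≡v (sym z≡v))
three-distinct-in-pair _ _ y≢z _ (inj₁ y≡u) (inj₁ z≡u) = y≢z (trans y≡u (sym z≡u))
three-distinct-in-pair _ _ y≢z _ (inj₂ y≡v) (inj₂ z≡v) = y≢z (trans y≡v (sym z≡v))

collapse-triple : ∀ {A : Set} {a b c : A} → a ≡ b ⊎ a ≡ c ⊎ b ≡ c →
  ∃₂ λ u v → ∀ {w} → w ≡ a ⊎ w ≡ b ⊎ w ≡ c → w ≡ u ⊎ w ≡ v
collapse-triple (inj₁ a≡b) = _ , _ , λ where
  (inj₁ w≡a)        → inj₁ w≡a
  (inj₂ (inj₁ w≡b)) → inj₁ (trans w≡b (sym a≡b))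
  (inj₂ (inj₂ w≡c)) → inj₂ w≡c
collapse-triple (inj₂ (inj₁ a≡c)) = _ , _ , λ where
  (inj₁ w≡a)        → inj₁ w≡a
  (inj₂ (inj₁ w≡b)) → inj₂ w≡b
  (inj₂ (inj₂ w≡c)) → inj₁ (trans w≡c (sym a≡c))
collapse-triple (inj₂ (inj₂ b≡c)) = _ , _ , λ where
  (inj₁ w≡a)        → inj₁ w≡a
  (inj₂ (inj₁ w≡b)) → inj₂ w≡b
  (inj₂ (inj₂ w≡c)) → inj₂ (trans w≡c (sym b≡c))

module RainbowFree (m n : ℕ) (c : Point → ℕ) (no-rainbow : NoRainbow m n c) where

  MainColour : ℕ → Set
  MainColour = InColorsMainDiag m n c

  Off : Point → Set
  Off p = InGrid m n p × ¬ MainColour (c p)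

  colours-collide : ∀ {p q} → InGrid m n p → InGrid m n q → InGrid m n (p ⊕ q) →
    c p ≡ c q ⊎ c p ≡ c (p ⊕ q) ⊎ c q ≡ c (p ⊕ q)
  colours-collide {p} {q} gp gq gs with c p ≟ c q | c p ≟ c (p ⊕ q) | c q ≟ c (p ⊕ q)
  ... | yes e | _     | _     = inj₁ e
  ... | no _  | yes e | _     = inj₂ (inj₁ e)
  ... | no _  | no _  | yes e = inj₂ (inj₂ e)
  ... | no ≢₁ | no ≢₂ | no ≢₃ = ⊥-elim (no-rainbow p q (p ⊕ q) (gp , gq , gs , refl , ≢₁ , ≢₂ , ≢₃))

  onMain-mainColour : ∀ {p} → InGrid m n p → proj₁ p ≡ proj₂ p → MainColour (c p)
  onMain-mainColour {p} g i≡j = p , (g , onMain⇒diagIndex≡m g i≡j) , refl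

  Off⇒offMain : ∀ {p} → Off p → proj₁ p ≢ proj₂ p
  Off⇒offMain (g , not-main) = not-main ∘ onMain-mainColour g

  Off-sameColour : ∀ {p q} → Off p → InGrid m n q → c p ≡ c q → Off q
  Off-sameColour (_ , not-main) gq eq = gq , not-main ∘ subst MainColour (sym eq)

  sameDiagonal⇒sameColour-< : ∀ {p q} → Off p → Off q → SameDiagonal p q → proj₁ p < proj₁ q →
    c p ≡ c q
  sameDiagonal⇒sameColour-< {p} op oq same p₁<q₁
    with δ , gδ , refl ← jump-difference p₁<q₁ (sameDiagonal-< same p₁<q₁) (proj₁ oq)
    with colours-collide (proj₁ op) gδ (proj₁ oq)
  ... | inj₁ cp≡cδ        = ⊥-elim (proj₂ op (subst MainColour (sym cp≡cδ) δ-main))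
    where
      δ-main : MainColour (c δ)
      δ-main = onMain-mainColour gδ (sameDiagonal-⊕ʳ p δ same)
  ... | inj₂ (inj₁ cp≡cq) = cp≡cq
  ... | inj₂ (inj₂ cδ≡cq) = ⊥-elim (proj₂ oq (subst MainColour cδ≡cq δ-main))
    where
      δ-main : MainColour (c δ)
      δ-main = onMain-mainColour gδ (sameDiagonal-⊕ʳ p δ same)

  sameDiagonal⇒sameColour : ∀ {p q} → Off p → Off q → SameDiagonal p q → c p ≡ c q
  sameDiagonal⇒sameColour {p₁ , p₂} {q₁ , q₂} op oq same with <-cmp p₁ q₁
  ... | tri< p₁<q₁ _ _ = sameDiagonal⇒sameColour-< op oq same p₁<q₁
  ... | tri≈ _ refl _  = cong (λ j → c (p₁ , j)) (sym (+-cancelˡ-≡ p₁ q₂ p₂ same))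
  ... | tri> _ _ q₁<p₁ = sym (sameDiagonal⇒sameColour-< oq op (sym same) q₁<p₁)

  main-colours-of-width-3 : m ≡ 3 → ∀ {w} → MainColour w →
    w ≡ c (1 , 1) ⊎ w ≡ c (2 , 2) ⊎ w ≡ c (3 , 3)
  main-colours-of-width-3 m≡3 ((i , _) , (g@((1≤i , i≤m) , _) , d) , refl)
    with refl ← diagIndex≡m⇒onMain g d = diagonal-colour i 1≤i (subst (i ≤_) m≡3 i≤m)
    where
      diagonal-colour : ∀ i → 1 ≤ i → i ≤ 3 →
        c (i , i) ≡ c (1 , 1) ⊎ c (i , i) ≡ c (2 , 2) ⊎ c (i , i) ≡ c (3 , 3)
      diagonal-colour 1 _ _ = inj₁ refl
      diagonal-colour 2 _ _ = inj₂ (inj₁ refl)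
      diagonal-colour 3 _ _ = inj₂ (inj₂ refl)
      diagonal-colour (suc (suc (suc (suc _)))) _ (s≤s (s≤s (s≤s ())))

  width≢3 : 3 ≤ n → MainDiagHas3Colors m n c → m ≢ 3
  width≢3 3≤n (x , y , z , x≢y , x≢z , y≢z , Dx , Dy , Dz , _) m≡3 =
    let _ , _ , into-pair = collapse-triple
          (colours-collide (diagonal z≤n) (diagonal (s≤s z≤n)) (diagonal (s≤s (s≤s z≤n))))
        in-pair = λ {w} (main : MainColour w) → into-pair (main-colours-of-width-3 m≡3 main)
    in three-distinct-in-pair x≢y x≢z y≢z (in-pair Dx) (in-pair Dy) (in-pair Dz)
    where
      diagonal : ∀ {i} → i ≤ 2 → InGrid m n (suc i , suc i)
      diagonal i≤2 = (s≤s z≤n , ≤-trans (s≤s i≤2) (≤-reflexive (sym m≡3)))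
                   , (s≤s z≤n , ≤-trans (s≤s i≤2) 3≤n)

  module Counting (0<m : 0 < m) (0<n : 0 < n)
    (exact : ∀ k → 1 ≤ k → k ≤ m + n + 1 → Σ Point λ p → InGrid m n p × c p ≡ k)
    (x y z : ℕ) (covers : ∀ w → MainColour w → w ≡ x ⊎ w ≡ y ⊎ w ≡ z) where

    Kind : ℕ → Set
    Kind k = k ≡ x ⊎ k ≡ y ⊎ k ≡ z ⊎ ¬ MainColour k

    kind : ∀ k → Kind k
    kind k with k ≟ x | k ≟ y | k ≟ z
    ... | yes e | _     | _     = inj₁ e
    ... | no _  | yes e | _     = inj₂ (inj₁ e)
    ... | no _  | no _  | yes e = inj₂ (inj₂ (inj₁ e))
    ... | no ≢x | no ≢y | no ≢z = inj₂ (inj₂ (inj₂ ([ ≢x , [ ≢y , ≢z ] ] ∘ covers k)))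

    -- The slots 0, m and m + n are exactly the values in [0, m + n] that are not indices
    -- of off-main diagonals; the three main colours are sent there.
    slotOf : ∀ {k} → Kind k → Point → ℕ
    slotOf (inj₁ _)               _ = 0
    slotOf (inj₂ (inj₁ _))        _ = m
    slotOf (inj₂ (inj₂ (inj₁ _))) _ = m + n
    slotOf (inj₂ (inj₂ (inj₂ _))) p = diagIndex m p

    slotAt : Point → ℕ
    slotAt p = slotOf (kind (c p)) p

    FreeSlot : ℕ → Set
    FreeSlot e = e ≢ 0 × e ≢ m × e ≢ m + n

    m+n<slots : m + n < m + n + 1
    m+n<slots = m<m+n (m + n) (s≤s z≤n)

    m≢0 : m ≢ 0
    m≢0 = >⇒≢ 0<m

    m+n≢0 : m + n ≢ 0
    m+n≢0 = >⇒≢ (<-≤-trans 0<m (m≤m+n m n))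

    m≢m+n : m ≢ m + n
    m≢m+n = <⇒≢ (m<m+n m 0<n)

    Off⇒freeSlot : ∀ {p} → Off p → FreeSlot (diagIndex m p)
    Off⇒freeSlot o@(g , _) =
      >⇒≢ (diagIndex>0 g) , Off⇒offMain o ∘ diagIndex≡m⇒onMain g , <⇒≢ (diagIndex<m+n g)

    slotOf-< : ∀ {k p} (κ : Kind k) → InGrid m n p → slotOf κ p < m + n + 1
    slotOf-< (inj₁ _)               _ = ≤-<-trans z≤n m+n<slots
    slotOf-< (inj₂ (inj₁ _))        _ = ≤-<-trans (m≤m+n m n) m+n<slots
    slotOf-< (inj₂ (inj₂ (inj₁ _))) _ = m+n<slots
    slotOf-< (inj₂ (inj₂ (inj₂ _))) g = <-trans (diagIndex<m+n g) m+n<slots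

    slotOf-free : ∀ {p} (κ : Kind (c p)) → InGrid m n p → FreeSlot (slotOf κ p) →
      Off p × diagIndex m p ≡ slotOf κ p
    slotOf-free (inj₁ _)                      _ (≢0 , _ , _)  = ⊥-elim (≢0 refl)
    slotOf-free (inj₂ (inj₁ _))               _ (_ , ≢m , _)  = ⊥-elim (≢m refl)
    slotOf-free (inj₂ (inj₂ (inj₁ _)))        _ (_ , _ , ≢m+n) = ⊥-elim (≢m+n refl)
    slotOf-free (inj₂ (inj₂ (inj₂ not-main))) g _             = (g , not-main) , refl

    slotOf-≡-diagIndex : ∀ {p q} (κ : Kind (c p)) → InGrid m n p → Off q →
      slotOf κ p ≡ diagIndex m q → c p ≡ c q
    slotOf-≡-diagIndex κ gp oq@(gq , _) e =
      let op , d = slotOf-free κ gp (subst FreeSlot (sym e) (Off⇒freeSlot oq))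
      in sameDiagonal⇒sameColour op oq (diagIndex≡⇒sameDiagonal gp gq (trans d e))

    slotOf-injective : ∀ {p q} (κ : Kind (c p)) (κ′ : Kind (c q)) → InGrid m n p → InGrid m n q →
      slotOf κ p ≡ slotOf κ′ q → c p ≡ c q
    slotOf-injective κ (inj₂ (inj₂ (inj₂ nm))) gp gq e = slotOf-≡-diagIndex κ gp (gq , nm) e
    slotOf-injective (inj₂ (inj₂ (inj₂ nm))) κ′ gp gq e = sym (slotOf-≡-diagIndex κ′ gq (gp , nm) (sym e))
    slotOf-injective (inj₁ p≡x)               (inj₁ q≡x)               _ _ _ = trans p≡x (sym q≡x)
    slotOf-injective (inj₂ (inj₁ p≡y))        (inj₂ (inj₁ q≡y))        _ _ _ = trans p≡y (sym q≡y)
    slotOf-injective (inj₂ (inj₂ (inj₁ p≡z))) (inj₂ (inj₂ (inj₁ q≡z))) _ _ _ = trans p≡z (sym q≡z)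
    slotOf-injective (inj₁ _)               (inj₂ (inj₁ _))        _ _ e = ⊥-elim (m≢0 (sym e))
    slotOf-injective (inj₁ _)               (inj₂ (inj₂ (inj₁ _))) _ _ e = ⊥-elim (m+n≢0 (sym e))
    slotOf-injective (inj₂ (inj₁ _))        (inj₁ _)               _ _ e = ⊥-elim (m≢0 e)
    slotOf-injective (inj₂ (inj₁ _))        (inj₂ (inj₂ (inj₁ _))) _ _ e = ⊥-elim (m≢m+n e)
    slotOf-injective (inj₂ (inj₂ (inj₁ _))) (inj₁ _)               _ _ e = ⊥-elim (m+n≢0 e)
    slotOf-injective (inj₂ (inj₂ (inj₁ _))) (inj₂ (inj₁ _))        _ _ e = ⊥-elim (m≢m+n (sym e))

    Colour : Set
    Colour = Fin (m + n + 1)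

    pointOf : Colour → Point
    pointOf i = proj₁ (exact (suc (toℕ i)) (s≤s z≤n) (Fin.toℕ<n i))

    pointOf-grid : ∀ i → InGrid m n (pointOf i)
    pointOf-grid i = proj₁ (proj₂ (exact (suc (toℕ i)) (s≤s z≤n) (Fin.toℕ<n i)))

    pointOf-colour-injective : ∀ {i j} → c (pointOf i) ≡ c (pointOf j) → i ≡ j
    pointOf-colour-injective {i} {j} e = Fin.toℕ-injective (suc-injective (begin
      suc (toℕ i)   ≡⟨ sym (colour i) ⟩
      c (pointOf i) ≡⟨ e ⟩
      c (pointOf j) ≡⟨ colour j ⟩
      suc (toℕ j)   ∎))
      where
        open ≡-Reasoning
        colour : ∀ i → c (pointOf i) ≡ suc (toℕ i)
        colour i = proj₂ (proj₂ (exact (suc (toℕ i)) (s≤s z≤n) (Fin.toℕ<n i)))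

    slot : Colour → ℕ
    slot i = slotAt (pointOf i)

    slot-< : ∀ i → slot i < m + n + 1
    slot-< i = slotOf-< (kind (c (pointOf i))) (pointOf-grid i)

    slot-injective : Injective _≡_ _≡_ slot
    slot-injective {i} {j} e = pointOf-colour-injective
      (slotOf-injective (kind (c (pointOf i))) (kind (c (pointOf j))) (pointOf-grid i) (pointOf-grid j) e)

    free-slot-occupied : ∀ {e} → e < m + n + 1 → FreeSlot e →
      ∃[ i ] Off (pointOf i) × diagIndex m (pointOf i) ≡ e
    free-slot-occupied {e} e<r free =
      let i , slot≡e = injection-into-range-onto slot slot-< slot-injective e e<r
          off , diag≡slot = slotOf-free (kind (c (pointOf i))) (pointOf-grid i)
                              (subst FreeSlot (sym slot≡e) free)
      in i , off , trans diag≡slot slot≡e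

    diagonal-representative : ∀ {p} → Off p →
      ∃[ i ] c (pointOf i) ≡ c p × diagIndex m (pointOf i) ≡ diagIndex m p
    diagonal-representative op@(gp , _) =
      let i , oi , di = free-slot-occupied (<-trans (diagIndex<m+n gp) m+n<slots) (Off⇒freeSlot op)
      in i , sameDiagonal⇒sameColour oi op (diagIndex≡⇒sameDiagonal (pointOf-grid i) gp di) , di

    sameColour⇒sameDiagonal : ∀ {p q} → Off p → Off q → c p ≡ c q → SameDiagonal p q
    sameColour⇒sameDiagonal op@(gp , _) oq@(gq , _) cp≡cq =
      let i , ci , di = diagonal-representative op
          j , cj , dj = diagonal-representative oq
          i≡j = pointOf-colour-injective (trans ci (trans cp≡cq (sym cj)))
      in diagIndex≡⇒sameDiagonal gp gq (trans (sym di) (trans (cong (diagIndex m ∘ pointOf) i≡j) dj))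

    upper-diagonal-occupied : ∀ t → 1 ≤ t → t < n → ∃[ x ] Off (x , t + x)
    upper-diagonal-occupied t 1≤t t<n =
      let i , oi , di = free-slot-occupied (<-trans m+t<m+n m+n<slots)
                          (m≢0 ∘ m+n≡0⇒m≡0 m , >⇒≢ (m<m+n m 1≤t) , <⇒≢ m+t<m+n)
      in point-above (diagIndex≡m+t⇒above (pointOf-grid i) di) oi
      where
        m+t<m+n : m + t < m + n
        m+t<m+n = +-monoʳ-< m t<n
        point-above : ∀ {p} → Above t p → Off p → ∃[ x ] Off (x , t + x)
        point-above (at x) o = x , o

    lower-diagonal-occupied : ∀ t → 1 ≤ t → t < m → ∃[ y ] Off (t + y , y)
    lower-diagonal-occupied t 1≤t t<m =
      let i , oi , di = free-slot-occupied (≤-<-trans m∸t≤m (≤-<-trans (m≤m+n m n) m+n<slots))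
                          (m>n⇒m∸n≢0 t<m , <⇒≢ (∸-monoʳ-< 1≤t (<⇒≤ t<m)) ,
                           <⇒≢ (≤-<-trans m∸t≤m (m<m+n m 0<n)))
      in point-below (diagIndex≡m∸t⇒below (pointOf-grid i) (<⇒≤ t<m) di) oi
      where
        m∸t≤m : m ∸ t ≤ m
        m∸t≤m = m∸n≤m m t
        point-below : ∀ {p} → Above t (swap p) → Off p → ∃[ y ] Off (t + y , y)
        point-below (at y) o = y , o

    jump-step : ∀ {p q} → Off p → Off q → c p ≢ c q → proj₁ p < proj₁ q → proj₂ p < proj₂ q →
      ∃[ δ ] Off δ × SameDiagonal p δ × p ⊕ δ ≡ q
    jump-step {p} op oq cp≢cq p₁<q₁ p₂<q₂
      with δ , gδ , refl ← jump-difference p₁<q₁ p₂<q₂ (proj₁ oq)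
      with colours-collide (proj₁ op) gδ (proj₁ oq)
    ... | inj₁ cp≡cδ        = δ , oδ , sameColour⇒sameDiagonal op oδ cp≡cδ , refl
      where
        oδ : Off δ
        oδ = Off-sameColour op gδ cp≡cδ
    ... | inj₂ (inj₁ cp≡cq) = ⊥-elim (cp≢cq cp≡cq)
    ... | inj₂ (inj₂ cδ≡cq) =
      ⊥-elim (Off⇒offMain op (sameDiagonal-⊕ˡ p δ (sameColour⇒sameDiagonal oδ oq cδ≡cq)))
      where
        oδ : Off δ
        oδ = Off-sameColour oq gδ (sym cδ≡cq)

    sum-outside : ∀ {p q} → Off p → Off q → ¬ SameDiagonal p q → ¬ InGrid m n (p ⊕ q)
    sum-outside {p} {q} op oq ¬same gs with colours-collide (proj₁ op) (proj₁ oq) gs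
    ... | inj₁ cp≡cq        = ¬same (sameColour⇒sameDiagonal op oq cp≡cq)
    ... | inj₂ (inj₁ cp≡cs) =
      Off⇒offMain oq (sameDiagonal-⊕ʳ p q (sameColour⇒sameDiagonal op (Off-sameColour op gs cp≡cs) cp≡cs))
    ... | inj₂ (inj₂ cq≡cs) =
      Off⇒offMain op (sameDiagonal-⊕ˡ p q (sameColour⇒sameDiagonal oq (Off-sameColour oq gs cq≡cs) cq≡cs))

    jump-steps-on-diagonal : ∀ {p q} → Off p → Off q → ¬ SameDiagonal p q →
      proj₁ p < proj₁ q → proj₂ p < proj₂ q → StepOnDiagonal p q
    jump-steps-on-diagonal {p} op oq ¬same p₁<q₁ p₂<q₂ =
      let δ , _ , same , p⊕δ≡q = jump-step op oq (¬same ∘ sameColour⇒sameDiagonal op oq) p₁<q₁ p₂<q₂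
      in subst (StepOnDiagonal p) p⊕δ≡q (sameDiagonal⇒stepOnDiagonal p δ same)

    sum-outside-swap : ∀ {p q} → Off (swap p) → Off (swap q) → ¬ SameDiagonal p q → ¬ InGrid n m (p ⊕ q)
    sum-outside-swap {p} {q} op oq ¬same =
      sum-outside op oq (¬same ∘ sameDiagonal-swap (swap p) (swap q)) ∘ InGrid-swap

    jump-steps-on-diagonal-swap : ∀ {p q} → Off (swap p) → Off (swap q) → ¬ SameDiagonal p q →
      proj₁ p < proj₁ q → proj₂ p < proj₂ q → StepOnDiagonal p q
    jump-steps-on-diagonal-swap {p} {q} op oq ¬same p₁<q₁ p₂<q₂ =
      sym (jump-steps-on-diagonal op oq (¬same ∘ sameDiagonal-swap (swap p) (swap q)) p₂<q₂ p₁<q₁)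

    module _ (4≤m : 4 ≤ m) (4≤n : 4 ≤ n) where

      module Upper = DoublingSums m n 4≤m 4≤n Off proj₁ sum-outside jump-steps-on-diagonal
        upper-diagonal-occupied (lower-diagonal-occupied 1 (s≤s z≤n) (≤-trans (s≤s (s≤s z≤n)) 4≤m))

      module Lower = DoublingSums n m 4≤n 4≤m (Off ∘ swap) (InGrid-swap ∘ proj₁) sum-outside-swap
        jump-steps-on-diagonal-swap lower-diagonal-occupied
        (upper-diagonal-occupied 1 (s≤s z≤n) (≤-trans (s≤s (s≤s z≤n)) 4≤n))

      no-jump : ∀ {α β} → Off α → Off β → c α ≢ c β → ¬ Jump m n α β
      no-jump {a₁ , a₂} oα oβ cα≢cβ (_ , _ , _ , a₁<b₁ , a₂<b₂)
        with (u , v) , oδ , same , refl ← jump-step oα oβ cα≢cβ a₁<b₁ a₂<b₂ | <-cmp a₁ a₂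
      ... | tri< a₁<a₂ _ _ = Upper.no-doubling-sum (m<n⇒0<n∸m a₁<a₂) aα (sameDiagonal-above aα same) oα oδ oβ
        where
          aα : Above (a₂ ∸ a₁) (a₁ , a₂)
          aα = above-difference a₁<a₂
      ... | tri≈ _ a₁≡a₂ _ = Off⇒offMain oα a₁≡a₂
      ... | tri> _ _ a₂<a₁ = Lower.no-doubling-sum (m<n⇒0<n∸m a₂<a₁) aα
                               (sameDiagonal-above aα (sameDiagonal-swap (a₁ , a₂) (u , v) same)) oα oδ oβ
        where
          aα : Above (a₁ ∸ a₂) (a₂ , a₁)
          aα = above-difference a₂<a₁

lemma3p2 : (m n : ℕ) → 3 ≤ m → m ≤ n → (c : Point → ℕ) →
    IsExactColoring m n (m + n + 1) c → NoRainbow m n c → MainDiagHas3Colors m n c →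
    ∀ α β → ¬ InColorsMainDiag m n c (c α) → ¬ InColorsMainDiag m n c (c β) →
    c α ≢ c β → ¬ Jump m n α β
lemma3p2 m n 3≤m m≤n c (_ , exact) no-rainbow three-colours@(x , y , z , _ , _ , _ , _ , _ , _ , covers)
  α β α-off β-off cα≢cβ jump@(gα , gβ , _) =
  Counting.no-jump 0<m 0<n exact x y z covers 4≤m 4≤n (gα , α-off) (gβ , β-off) cα≢cβ jump
  where
    open RainbowFree m n c no-rainbow
    0<m : 0 < m
    0<m = ≤-trans (s≤s z≤n) 3≤m
    0<n : 0 < n
    0<n = ≤-trans 0<m m≤n
    4≤m : 4 ≤ m
    4≤m = ≤∧≢⇒< 3≤m (width≢3 (≤-trans 3≤m m≤n) three-colours ∘ sym)
    4≤n : 4 ≤ n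
    4≤n = ≤-trans 4≤m m≤n
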